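{- Let $\alpha\in\mathcal{P}(n)$ with $\delta(\alpha)=\big(1,2,\dots,q,q^{(s_q)},(q-1)^{(s_{q-1})},\dots,1^{(s_1)}\big)$ ($q>0$, $s_i\ge0$ integers). Let $\overline{\alpha}=(\overline{\alpha}_1,\dots,\overline{\alpha}_q)$ with $\overline{\alpha}_i=q-i+1+\sum_{k=i}^q s_k$ and $\underline{\alpha}=\overline{\alpha}^*$. Then $\delta(\overline{\alpha})=\delta(\underline{\alpha})$, and the multiset of nonzero entries of this sequence is equal to the multiset of parts of $\underline{\alpha}$.
   Context: $\mathcal{P}(n)$ is the set of partitions $\alpha=(\alpha_1\ge\dots\ge\alpha_t\ge1)$ of $n$, with $\alpha_i=0$ for $i>t$. The diagonal sequence is $\delta(\alpha)=(d_k)_{k\ge1}$ with $d_k=\big|\{i:1\le i\le k,\ \alpha_i+i-1\ge k\}\big|$, trailing zeros omitted. The notation $m^{(s)}$ means $s$ consecutive entries equal to $m$. $\beta^*$ denotes the conjugate partition. -}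

module Defs where

open import Data.Nat using (ℕ; zero; suc; _+_; _∸_; _≤_; _≥_; _≤?_)
open import Data.List using (List; []; _∷_; map; filter; length; upTo; reverse; replicate; concat; _++_)
open import Data.Nat.ListAction using (sum)
open import Data.List.Relation.Unary.All using (All)
open import Data.List.Relation.Unary.Linked using (Linked)
open import Relation.Binary.PropositionalEquality using (_≡_)
open import Data.Product using (_×_)

-- Partitions are represented as finite lists of their nonzero parts.

range1 : ℕ → List ℕ
range1 k = map suc (upTo k)

IsPartition : ℕ → List ℕ → Set
IsPartition n α = Linked _≥_ α × All (λ x → 1 ≤ x) α × sum α ≡ n

-- 1-based part lookup, α_i = 0 for i beyond the length (and α_0 := 0, unused).
part : List ℕ → ℕ → ℕ
part []      _             = 0
part (x ∷ α) zero          = 0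
part (x ∷ α) (suc zero)    = x
part (x ∷ α) (suc (suc i)) = part α (suc i)

diag : List ℕ → ℕ → ℕ
diag α k = length (filter (λ i → k ≤? part α i + i ∸ 1) (range1 k))

dropTrailingZeros : List ℕ → List ℕ
dropTrailingZeros xs = reverse (dropZ (reverse xs))
  where
  dropZ : List ℕ → List ℕ
  dropZ []            = []
  dropZ (zero ∷ ys)   = dropZ ys
  dropZ (suc y ∷ ys)  = suc y ∷ ys

-- Diagonal sequence δ(α) = (d_1, d_2, ...) with trailing zeros omitted.
-- d_k = 0 for k > sum α + length α (since α_i + i - 1 ≤ that bound), so it
-- suffices to compute d_1 … d_N for N = sum α + length α.
δ : List ℕ → List ℕ
δ α = dropTrailingZeros (map (diag α) (range1 (sum α + length α)))

conj : List ℕ → List ℕ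
conj β = map (λ j → length (filter (λ x → j ≤? x) β)) (range1 (part β 1))

shape : ℕ → (ℕ → ℕ) → List ℕ
shape q s = range1 q ++ concat (map (λ k → replicate (s (q ∸ k)) (q ∸ k)) (upTo q))

αbar : ℕ → (ℕ → ℕ) → List ℕ
αbar q s = map (λ i → (q ∸ i) + 1 + sum (map (λ k → s (i + k)) (upTo (suc (q ∸ i))))) (range1 q)

nonzero : List ℕ → List ℕ
nonzero = filter (λ x → 1 ≤? x)

-- Write d_k(λ) = #{ i < k : λ_{i+1} ≥ k − i }.  The Galois connection
-- λ*_j ≥ m + 1 ⇔ λ_{m+1} ≥ j, applied with j = k − i, makes the reflection
-- i ↦ k − 1 − i of {0, …, k − 1} match the terms counted by d_k(λ*) with those
-- counted by d_k(λ); hence δ(λ*) = δ(λ) for every partition λ.  If the parts of λ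
-- are distinct, d_k(λ) is positive for k ≤ λ_1 and zero beyond, and adding a new
-- largest part a + 1 turns (d_1, …, d_{λ_1}) into (1, d_1 + 1, …, d_{λ_1} + 1, 1, …, 1)
-- with a − λ_1 final ones, while it turns λ* into (λ*_1 + 1, …, λ*_{λ_1} + 1, 1, …, 1)
-- with a + 1 − λ_1 ones; by induction the nonzero entries of δ(λ) are the parts of
-- λ* up to order.  Both facts apply to ᾱ, whose parts are distinct because
-- ᾱ_i − ᾱ_{i+1} = 1 + s_i.

module Submission where

open import Defs
open import Data.Nat using (ℕ; zero; suc; _+_; _∸_; _≤_; _<_; _≥_; _>_; z≤n; s≤s; s≤s⁻¹; _≤?_)
open import Data.Nat.Properties
open import Data.Nat.ListAction using (sum)
open import Data.Product using (_×_; _,_)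
open import Data.Sum using (inj₁; inj₂)
open import Data.List using (List; []; _∷_; head; map; filter; length; upTo; applyUpTo; downFrom; reverse; replicate; _++_; _∷ʳ_)
open import Data.List.Properties
open import Data.List.Membership.Propositional.Properties using (∈-upTo⁻)
open import Data.List.Relation.Unary.All as All using (All; []; _∷_)
import Data.List.Relation.Unary.All.Properties as All
open import Data.List.Relation.Unary.Linked as Linked using (Linked; []; _∷_; _∷′_)
open import Data.List.Relation.Unary.Linked.Properties using (Linked⇒All)
open import Data.List.Relation.Binary.Permutation.Propositional using (_↭_; ↭-refl; ↭-sym; ↭-trans; ↭-reflexive; prep; module PermutationReasoning)
import Data.List.Relation.Binary.Permutation.Propositional.Properties as ↭
open ↭ using (↭-length; filter-↭)
open import Data.Maybe using (just)
open import Data.Maybe.Relation.Binary.Connected as Connected using (Connected; just-nothing)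
open import Function using (_∘_; _⇔_; mk⇔; Equivalence)
open import Function.Properties.Equivalence using () renaming (trans to ⇔-trans; sym to ⇔-sym)
open import Level using (0ℓ)
open import Relation.Binary.PropositionalEquality
open import Relation.Nullary using (Dec; yes; no; ¬_)
open import Relation.Nullary.Negation using (contradiction)
open import Relation.Unary using (Pred; Decidable)

open Equivalence using (to; from)

upTo-All : ∀ {P : Pred ℕ 0ℓ} {n} → (∀ {i} → i < n → P i) → All P (upTo n)
upTo-All p = All.tabulate (p ∘ ∈-upTo⁻)

range1-All : ∀ {P : Pred ℕ 0ℓ} {n} → (∀ {j} → 1 ≤ j → j ≤ n → P j) → All P (range1 n)
range1-All p = All.map⁺ (upTo-All (p (s≤s z≤n)))

sum-map-upTo-suc : ∀ (f : ℕ → ℕ) n → sum (map f (upTo (suc n))) ≡ f 0 + sum (map (f ∘ suc) (upTo n))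
sum-map-upTo-suc f n = cong (λ ys → f 0 + sum ys) (trans (map-applyUpTo suc f n) (sym (map-upTo (f ∘ suc) n)))

range1-suc : ∀ n → range1 (suc n) ≡ 1 ∷ map suc (range1 n)
range1-suc n = cong (λ is → 1 ∷ map suc is) (sym (map-upTo suc n))

range1-∷ʳ : ∀ n → range1 (suc n) ≡ range1 n ∷ʳ suc n
range1-∷ʳ n = trans (cong (map suc) (sym (upTo-∷ʳ n))) (map-++ suc (upTo n) (n ∷ []))

range1-+ : ∀ h r → range1 (h + r) ≡ range1 h ++ map (h +_) (range1 r)
range1-+ zero r = sym (map-id (range1 r))
range1-+ (suc h) r = begin
  range1 (suc (h + r))                                        ≡⟨ range1-suc (h + r) ⟩
  1 ∷ map suc (range1 (h + r))                                ≡⟨ cong (λ is → 1 ∷ map suc is) (range1-+ h r) ⟩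
  1 ∷ map suc (range1 h ++ map (h +_) (range1 r))             ≡⟨ cong (1 ∷_) (map-++ suc (range1 h) _) ⟩
  1 ∷ map suc (range1 h) ++ map suc (map (h +_) (range1 r))   ≡⟨ cong (λ is → 1 ∷ map suc (range1 h) ++ is) (sym (map-∘ (range1 r))) ⟩
  1 ∷ map suc (range1 h) ++ map (suc h +_) (range1 r)         ≡⟨ cong (_++ map (suc h +_) (range1 r)) (sym (range1-suc h)) ⟩
  range1 (suc h) ++ map (suc h +_) (range1 r)                 ∎
  where open ≡-Reasoning

map-range1-constant : ∀ (f : ℕ → ℕ) {c} r → (∀ {k} → 1 ≤ k → k ≤ r → f k ≡ c) →
                      map f (range1 r) ≡ replicate r c
map-range1-constant f zero fk≡c = refl
map-range1-constant f {c} (suc r) fk≡c = begin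
  map f (range1 (suc r))           ≡⟨ cong (map f) (range1-suc r) ⟩
  f 1 ∷ map f (map suc (range1 r)) ≡⟨ cong₂ _∷_ (fk≡c ≤-refl (s≤s z≤n)) (sym (map-∘ (range1 r))) ⟩
  c ∷ map (f ∘ suc) (range1 r)     ≡⟨ cong (c ∷_) (map-range1-constant (f ∘ suc) r shifted) ⟩
  c ∷ replicate r c                ∎
  where
  open ≡-Reasoning
  shifted : ∀ {k} → 1 ≤ k → k ≤ r → f (suc k) ≡ c
  shifted _ k≤r = fk≡c (s≤s z≤n) (s≤s k≤r)

map-range1-split : ∀ (f : ℕ → ℕ) {c h n} → h ≤ n → (∀ {k} → h < k → f k ≡ c) →
                   map f (range1 n) ≡ map f (range1 h) ++ replicate (n ∸ h) c
map-range1-split f {c} {h} {n} h≤n fk≡c = begin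
  map f (range1 n)                                         ≡⟨ cong (map f ∘ range1) (m+[n∸m]≡n h≤n) ⟨
  map f (range1 (h + r))                                   ≡⟨ cong (map f) (range1-+ h r) ⟩
  map f (range1 h ++ map (h +_) (range1 r))                ≡⟨ map-++ f (range1 h) _ ⟩
  map f (range1 h) ++ map f (map (h +_) (range1 r))        ≡⟨ cong (map f (range1 h) ++_) (map-∘ (range1 r)) ⟨
  map f (range1 h) ++ map (f ∘ (h +_)) (range1 r)          ≡⟨ cong (map f (range1 h) ++_) (map-range1-constant (f ∘ (h +_)) r beyond) ⟩
  map f (range1 h) ++ replicate r c                        ∎
  where
  open ≡-Reasoning
  r = n ∸ h
  beyond : ∀ {k} → 1 ≤ k → k ≤ r → f (h + k) ≡ c
  beyond {k} 1≤k _ = fk≡c (subst (_≤ h + k) (+-comm h 1) (+-monoʳ-≤ h 1≤k))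

part-map-range1 : ∀ (f : ℕ → ℕ) n j → 1 ≤ j → j ≤ n → part (map f (range1 n)) j ≡ f j
part-map-range1 f (suc n) (suc zero) _ _ = cong (λ is → part (map f is) 1) (range1-suc n)
part-map-range1 f (suc n) (suc (suc j)) _ (s≤s j<n) = begin
  part (map f (range1 (suc n))) (suc (suc j))  ≡⟨ cong (λ is → part (map f is) (suc (suc j))) (range1-suc n) ⟩
  part (map f (map suc (range1 n))) (suc j)    ≡⟨ cong (λ is → part is (suc j)) (sym (map-∘ (range1 n))) ⟩
  part (map (f ∘ suc) (range1 n)) (suc j)      ≡⟨ part-map-range1 (f ∘ suc) n (suc j) (s≤s z≤n) j<n ⟩
  f (suc (suc j))                              ∎
  where open ≡-Reasoning

part-map-range1-> : ∀ (f : ℕ → ℕ) n j → n < j → part (map f (range1 n)) j ≡ 0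
part-map-range1-> f zero j _ = refl
part-map-range1-> f (suc n) (suc (suc j)) (s≤s n<j) = begin
  part (map f (range1 (suc n))) (suc (suc j))  ≡⟨ cong (λ is → part (map f is) (suc (suc j))) (range1-suc n) ⟩
  part (map f (map suc (range1 n))) (suc j)    ≡⟨ cong (λ is → part is (suc j)) (sym (map-∘ (range1 n))) ⟩
  part (map (f ∘ suc) (range1 n)) (suc j)      ≡⟨ part-map-range1-> (f ∘ suc) n (suc j) n<j ⟩
  0                                            ∎
  where open ≡-Reasoning

module _ {A : Set} {P Q : Pred A 0ℓ} (P? : Decidable P) (Q? : Decidable Q) where

  filter-cong-local : ∀ {xs} → All (λ x → P x ⇔ Q x) xs → filter P? xs ≡ filter Q? xs
  filter-cong-local {[]} [] = refl
  filter-cong-local {x ∷ xs} (Px⇔Qx ∷ eqs) with P? x | Q? x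
  ... | yes _  | yes _  = cong (x ∷_) (filter-cong-local eqs)
  ... | yes Px | no ¬Qx = contradiction (to Px⇔Qx Px) ¬Qx
  ... | no ¬Px | yes Qx = contradiction (from Px⇔Qx Qx) ¬Px
  ... | no _   | no _   = filter-cong-local eqs

  filter-cong : (∀ x → P x ⇔ Q x) → ∀ xs → filter P? xs ≡ filter Q? xs
  filter-cong P⇔Q xs = filter-cong-local (All.universal P⇔Q xs)

length-filter-map : ∀ {A B : Set} {P : Pred B 0ℓ} (P? : Decidable P) (f : A → B) xs →
                    length (filter P? (map f xs)) ≡ length (filter (P? ∘ f) xs)
length-filter-map P? f [] = refl
length-filter-map P? f (x ∷ xs) with P? (f x)
... | yes _ = cong suc (length-filter-map P? f xs)
... | no _  = length-filter-map P? f xs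

-- d_k with i shifted to 0 … k − 1, which removes the truncated subtraction of Defs.
reaches? : ∀ xs k i → Dec (k ≤ i + part xs (suc i))
reaches? xs k i = k ≤? i + part xs (suc i)

diag₀ : List ℕ → ℕ → ℕ
diag₀ xs k = length (filter (reaches? xs k) (upTo k))

diag≡diag₀ : ∀ xs k → diag xs k ≡ diag₀ xs k
diag≡diag₀ xs k = trans (length-filter-map _ suc (upTo k)) (cong length (filter-cong _ _ reindex (upTo k)))
  where
  reindex : ∀ i → k ≤ part xs (suc i) + suc i ∸ 1 ⇔ k ≤ i + part xs (suc i)
  reindex i = mk⇔ (subst (k ≤_) e) (subst (k ≤_) (sym e))
    where
    e : part xs (suc i) + suc i ∸ 1 ≡ i + part xs (suc i)
    e = trans (cong (_∸ 1) (+-suc (part xs (suc i)) i)) (+-comm (part xs (suc i)) i)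

diag₀-∷-tail : ∀ a xs k →
  length (filter (reaches? (a ∷ xs) (suc k)) (applyUpTo suc k)) ≡ diag₀ xs k
diag₀-∷-tail a xs k = begin
  length (filter P? (applyUpTo suc k))   ≡⟨ cong (length ∘ filter P?) (sym (map-upTo suc k)) ⟩
  length (filter P? (map suc (upTo k)))  ≡⟨ length-filter-map P? suc (upTo k) ⟩
  length (filter (P? ∘ suc) (upTo k))    ≡⟨ cong length (filter-cong _ _ (λ _ → mk⇔ s≤s⁻¹ s≤s) (upTo k)) ⟩
  diag₀ xs k                             ∎
  where
  open ≡-Reasoning
  P? = reaches? (a ∷ xs) (suc k)

diag₀-∷-≤ : ∀ {a} xs {k} → suc k ≤ a → diag₀ (a ∷ xs) (suc k) ≡ suc (diag₀ xs k)
diag₀-∷-≤ {a} xs {k} k<a =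
  trans (cong length (filter-accept (reaches? (a ∷ xs) (suc k)) {x = 0} {xs = applyUpTo suc k} k<a))
        (cong suc (diag₀-∷-tail a xs k))

diag₀-∷-> : ∀ {a} xs {k} → a < suc k → diag₀ (a ∷ xs) (suc k) ≡ diag₀ xs k
diag₀-∷-> {a} xs {k} a≤k =
  trans (cong length (filter-reject (reaches? (a ∷ xs) (suc k)) {x = 0} {xs = applyUpTo suc k} (<⇒≱ a≤k)))
        (diag₀-∷-tail a xs k)

count≥ : ℕ → List ℕ → ℕ
count≥ j xs = length (filter (j ≤?_) xs)

part-≤-head : ∀ {x xs} → Linked _≥_ (x ∷ xs) → ∀ m → part (x ∷ xs) m ≤ x
part-≤-head _ zero = z≤n
part-≤-head _ (suc zero) = ≤-refl
part-≤-head {xs = []} _ (suc (suc m)) = z≤n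
part-≤-head {xs = _ ∷ _} (y≤x ∷ sorted) (suc (suc m)) = ≤-trans (part-≤-head sorted (suc m)) y≤x

count≥-> : ∀ {xs j} → Linked _≥_ xs → part xs 1 < j → count≥ j xs ≡ 0
count≥-> {[]} _ _ = refl
count≥-> {x ∷ xs} {j} sorted x<j = cong length (filter-none (j ≤?_) (All.map below bounded))
  where
  bounded : All (_≤ x) (x ∷ xs)
  bounded = Linked⇒All (λ z≤y y≤x → ≤-trans y≤x z≤y) ≤-refl sorted
  below : ∀ {y} → y ≤ x → ¬ j ≤ y
  below y≤x j≤y = <⇒≱ x<j (≤-trans j≤y y≤x)

count≥-⇔ : ∀ {xs} → Linked _≥_ xs → ∀ {j} m → 1 ≤ j → suc m ≤ count≥ j xs ⇔ j ≤ part xs (suc m)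
count≥-⇔ {[]} _ _ 1≤j = mk⇔ (λ ()) (λ j≤0 → contradiction (≤-trans 1≤j j≤0) λ ())
count≥-⇔ {x ∷ xs} sorted {j} m 1≤j with j ≤? x
... | no j≰x = mk⇔ (λ m<0 → contradiction (subst (suc m ≤_) none m<0) λ ())
                   (λ j≤part → contradiction (≤-trans j≤part (part-≤-head sorted (suc m))) j≰x)
  where
  none : count≥ j (x ∷ xs) ≡ 0
  none = count≥-> sorted (≰⇒> j≰x)
... | yes j≤x = counted m
  where
  one-more : count≥ j (x ∷ xs) ≡ suc (count≥ j xs)
  one-more = cong length (filter-accept (j ≤?_) {xs = xs} j≤x)
  counted : ∀ m → suc m ≤ count≥ j (x ∷ xs) ⇔ j ≤ part (x ∷ xs) (suc m)
  counted zero = mk⇔ (λ _ → j≤x) (λ _ → subst (1 ≤_) (sym one-more) (s≤s z≤n))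
  counted (suc m) = mk⇔ (λ h → to ih (s≤s⁻¹ (subst (suc (suc m) ≤_) one-more h)))
                        (λ h → subst (suc (suc m) ≤_) (sym one-more) (s≤s (from ih h)))
    where ih = count≥-⇔ (Linked.tail sorted) m 1≤j

part-conj : ∀ {xs} → Linked _≥_ xs → ∀ {j} → 1 ≤ j → part (conj xs) j ≡ count≥ j xs
part-conj {xs} sorted {j} 1≤j with j ≤? part xs 1
... | yes j≤x₁ = part-map-range1 (λ j → count≥ j xs) (part xs 1) j 1≤j j≤x₁
... | no j≰x₁  = trans (part-map-range1-> (λ j → count≥ j xs) (part xs 1) j (≰⇒> j≰x₁))
                       (sym (count≥-> sorted (≰⇒> j≰x₁)))

+-≤-⇔ : ∀ {i c k p} → i + c ≡ k → k ≤ i + p ⇔ c ≤ p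
+-≤-⇔ {i} refl = mk⇔ (+-cancelˡ-≤ i _ _) (+-monoʳ-≤ i)

map-reflect-upTo : ∀ k → map (λ i → k ∸ suc i) (upTo k) ≡ reverse (upTo k)
map-reflect-upTo k = trans (go k) (sym (reverse-upTo k))
  where
  go : ∀ k → map (λ i → k ∸ suc i) (upTo k) ≡ downFrom k
  go zero = refl
  go (suc k) = cong (k ∷_) (trans (cong (map (λ i → suc k ∸ suc i)) (sym (map-upTo suc k)))
                                  (trans (sym (map-∘ (upTo k))) (go k)))

diag₀-conj : ∀ {xs} → Linked _≥_ xs → ∀ k → diag₀ (conj xs) k ≡ diag₀ xs k
diag₀-conj {xs} sorted k = begin
  length (filter Q? (upTo k))            ≡⟨ ↭-length (filter-↭ Q? reflection) ⟨
  length (filter Q? (map r (upTo k)))    ≡⟨ length-filter-map Q? r (upTo k) ⟩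
  length (filter (Q? ∘ r) (upTo k))      ≡⟨ cong length (filter-cong-local _ _ (upTo-All reflected)) ⟩
  diag₀ xs k                             ∎
  where
  open ≡-Reasoning
  r = λ i → k ∸ suc i
  Q? = reaches? (conj xs) k
  reflection : map r (upTo k) ↭ upTo k
  reflection = ↭-trans (↭-reflexive (map-reflect-upTo k)) (↭.↭-reverse (upTo k))
  reflected : ∀ {i} → i < k → k ≤ r i + part (conj xs) (suc (r i)) ⇔ k ≤ i + part xs (suc i)
  reflected {i} i<k =
    ⇔-trans (subst (λ p → k ≤ r i + part (conj xs) (suc (r i)) ⇔ suc i ≤ p) conj-entry (+-≤-⇔ (m∸n+n≡m i<k)))
   (⇔-trans (count≥-⇔ sorted i 1≤k∸i)
            (⇔-sym (+-≤-⇔ (m+[n∸m]≡n (<⇒≤ i<k)))))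
    where
    suc-r : suc (r i) ≡ k ∸ i
    suc-r = sym (+-∸-assoc 1 i<k)
    1≤k∸i : 1 ≤ k ∸ i
    1≤k∸i = subst (1 ≤_) suc-r (s≤s z≤n)
    conj-entry : part (conj xs) (suc (r i)) ≡ count≥ (k ∸ i) xs
    conj-entry = trans (cong (part (conj xs)) suc-r) (part-conj sorted 1≤k∸i)

i+part[1+i]<k : ∀ xs i {k} → i < k → sum xs + length xs < k → i + part xs (suc i) < k
i+part[1+i]<k [] i i<k _ = subst (_< _) (sym (+-identityʳ i)) i<k
i+part[1+i]<k (x ∷ xs) zero _ bound = ≤-<-trans (≤-trans (m≤m+n x (sum xs)) (m≤m+n (x + sum xs) _)) bound
i+part[1+i]<k (x ∷ xs) (suc i) {suc k} (s≤s i<k) bound = s≤s (i+part[1+i]<k xs i i<k bound′)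
  where
  bound′ : sum xs + length xs < k
  bound′ = ≤-trans (≤-reflexive (sym (+-suc (sum xs) (length xs))))
          (≤-trans (+-monoˡ-≤ (suc (length xs)) (m≤n+m (sum xs) x)) (s≤s⁻¹ bound))

diag-vanish : ∀ xs {k} → sum xs + length xs < k → diag xs k ≡ 0
diag-vanish xs {k} bound = trans (diag≡diag₀ xs k)
  (cong length (filter-none _ (upTo-All (λ i<k → <⇒≱ (i+part[1+i]<k xs _ i<k bound)))))

dropTrailingZeros-∷ʳ-0 : ∀ xs → dropTrailingZeros (xs ∷ʳ 0) ≡ dropTrailingZeros xs
dropTrailingZeros-∷ʳ-0 xs rewrite reverse-++ xs (0 ∷ []) = refl

dropTrailingZeros-positive : ∀ {xs} → All (1 ≤_) xs → dropTrailingZeros xs ≡ xs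
dropTrailingZeros-positive {xs} positive =
  untouched (reverse xs) refl (↭.All-resp-↭ (↭-sym (↭.↭-reverse xs)) positive)
  where
  untouched : ∀ ys → reverse xs ≡ ys → All (1 ≤_) ys → dropTrailingZeros xs ≡ xs
  untouched [] eq _ rewrite eq = trans (cong reverse (sym eq)) (reverse-involutive xs)
  untouched (suc _ ∷ _) eq _ rewrite eq = trans (cong reverse (sym eq)) (reverse-involutive xs)
  untouched (zero ∷ _) _ (() ∷ _)

dropTrailingZeros-map-range1 : ∀ (f : ℕ → ℕ) {M N} → (∀ {k} → M < k → f k ≡ 0) → M ≤ N →
  dropTrailingZeros (map f (range1 N)) ≡ dropTrailingZeros (map f (range1 M))
dropTrailingZeros-map-range1 f {N = zero} _ z≤n = refl
dropTrailingZeros-map-range1 f {M} {suc N} vanish M≤1+N with m≤n⇒m<n∨m≡n M≤1+N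
... | inj₂ refl = refl
... | inj₁ (s≤s M≤N) = begin
  dropTrailingZeros (map f (range1 (suc N)))                ≡⟨ cong (dropTrailingZeros ∘ map f) (range1-∷ʳ N) ⟩
  dropTrailingZeros (map f (range1 N ∷ʳ suc N))             ≡⟨ cong dropTrailingZeros (map-++ f (range1 N) _) ⟩
  dropTrailingZeros (map f (range1 N) ∷ʳ f (suc N))         ≡⟨ cong (dropTrailingZeros ∘ (map f (range1 N) ∷ʳ_)) (vanish (s≤s M≤N)) ⟩
  dropTrailingZeros (map f (range1 N) ∷ʳ 0)                 ≡⟨ dropTrailingZeros-∷ʳ-0 (map f (range1 N)) ⟩
  dropTrailingZeros (map f (range1 N))                      ≡⟨ dropTrailingZeros-map-range1 f vanish M≤N ⟩
  dropTrailingZeros (map f (range1 M))                      ∎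
  where open ≡-Reasoning

δ-trim : ∀ xs M → (∀ {k} → M < k → diag xs k ≡ 0) → δ xs ≡ dropTrailingZeros (map (diag xs) (range1 M))
δ-trim xs M vanish with ≤-total M (sum xs + length xs)
... | inj₁ M≤N = dropTrailingZeros-map-range1 (diag xs) vanish M≤N
... | inj₂ N≤M = sym (dropTrailingZeros-map-range1 (diag xs) (diag-vanish xs) N≤M)

diag-conj : ∀ {xs} → Linked _≥_ xs → ∀ k → diag (conj xs) k ≡ diag xs k
diag-conj {xs} sorted k = begin
  diag (conj xs) k   ≡⟨ diag≡diag₀ (conj xs) k ⟩
  diag₀ (conj xs) k  ≡⟨ diag₀-conj sorted k ⟩
  diag₀ xs k         ≡⟨ diag≡diag₀ xs k ⟨
  diag xs k          ∎
  where open ≡-Reasoning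

δ-conj : ∀ {xs} → Linked _≥_ xs → δ (conj xs) ≡ δ xs
δ-conj {xs} sorted = begin
  δ (conj xs)                                          ≡⟨ δ-trim (conj xs) N vanish ⟩
  dropTrailingZeros (map (diag (conj xs)) (range1 N))  ≡⟨ cong dropTrailingZeros (map-cong (diag-conj sorted) (range1 N)) ⟩
  δ xs                                                 ∎
  where
  open ≡-Reasoning
  N = sum xs + length xs
  vanish : ∀ {k} → N < k → diag (conj xs) k ≡ 0
  vanish {k} N<k = trans (diag-conj sorted k) (diag-vanish xs N<k)

diag₀-[] : ∀ k → diag₀ [] k ≡ 0
diag₀-[] zero = refl
diag₀-[] (suc k) = trans (sym (diag≡diag₀ [] (suc k))) (diag-vanish [] {suc k} (s≤s z≤n))

diag₀-strict-vanish : ∀ {xs} → Linked _>_ xs → ∀ {k} → part xs 1 < k → diag₀ xs k ≡ 0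
diag₀-strict-vanish {[]} _ {k} _ = diag₀-[] k
diag₀-strict-vanish {a ∷ []} _ {suc k} a≤k = trans (diag₀-∷-> [] a≤k) (diag₀-[] k)
diag₀-strict-vanish {a ∷ b ∷ xs} (b<a ∷ strict) {suc k} a≤k =
  trans (diag₀-∷-> (b ∷ xs) a≤k) (diag₀-strict-vanish strict (<-≤-trans b<a (s≤s⁻¹ a≤k)))

diag₀-positive : ∀ xs {k} → 1 ≤ k → k ≤ part xs 1 → 1 ≤ diag₀ xs k
diag₀-positive (a ∷ xs) {suc k} _ k<a = subst (1 ≤_) (sym (diag₀-∷-≤ xs k<a)) (s≤s z≤n)

strict⇒tail-head≤ : ∀ {a xs} → Linked _>_ (suc a ∷ xs) → part xs 1 ≤ a
strict⇒tail-head≤ {xs = []} _ = z≤n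
strict⇒tail-head≤ {xs = _ ∷ _} (b<1+a ∷ _) = s≤s⁻¹ b<1+a

map-diag₀-∷ : ∀ {a xs} → Linked _>_ (suc a ∷ xs) →
  map (diag₀ (suc a ∷ xs)) (range1 (suc a))
    ≡ 1 ∷ map suc (map (diag₀ xs) (range1 (part xs 1))) ++ replicate (a ∸ part xs 1) 1
map-diag₀-∷ {a} {xs} strict = begin
  map D (range1 (suc a))                                ≡⟨ cong (map D) (range1-suc a) ⟩
  D 1 ∷ map D (map suc (range1 a))                      ≡⟨ cong₂ _∷_ (grown (s≤s z≤n)) (sym (map-∘ (range1 a))) ⟩
  1 ∷ map (D ∘ suc) (range1 a)                          ≡⟨ cong (1 ∷_) (map-cong-local (range1-All (λ _ → grown ∘ s≤s))) ⟩
  1 ∷ map (suc ∘ diag₀ xs) (range1 a)                   ≡⟨ cong (1 ∷_) (map-range1-split _ h≤a vanish) ⟩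
  1 ∷ map (suc ∘ diag₀ xs) (range1 h) ++ ones           ≡⟨ cong (λ ys → 1 ∷ ys ++ ones) (map-∘ (range1 h)) ⟩
  1 ∷ map suc (map (diag₀ xs) (range1 h)) ++ ones       ∎
  where
  open ≡-Reasoning
  D = diag₀ (suc a ∷ xs)
  h = part xs 1
  grown : ∀ {k} → suc k ≤ suc a → D (suc k) ≡ suc (diag₀ xs k)
  grown = diag₀-∷-≤ xs
  ones = replicate (a ∸ h) 1
  h≤a : h ≤ a
  h≤a = strict⇒tail-head≤ strict
  vanish : ∀ {k} → h < k → suc (diag₀ xs k) ≡ 1
  vanish = cong suc ∘ diag₀-strict-vanish (Linked.tail strict)

conj-∷ : ∀ {a xs} → Linked _≥_ (a ∷ xs) → conj (a ∷ xs) ≡ map suc (conj xs) ++ replicate (a ∸ part xs 1) 1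
conj-∷ {a} {xs} sorted = begin
  map (λ j → count≥ j (a ∷ xs)) (range1 a)          ≡⟨ map-cong-local (range1-All counted) ⟩
  map (suc ∘ C) (range1 a)                          ≡⟨ map-range1-split _ (part-≤-head sorted 2) vanish ⟩
  map (suc ∘ C) (range1 h) ++ replicate (a ∸ h) 1   ≡⟨ cong (_++ replicate (a ∸ h) 1) (map-∘ (range1 h)) ⟩
  map suc (conj xs) ++ replicate (a ∸ h) 1          ∎
  where
  open ≡-Reasoning
  C = λ j → count≥ j xs
  h = part xs 1
  counted : ∀ {j} → 1 ≤ j → j ≤ a → count≥ j (a ∷ xs) ≡ suc (C j)
  counted {j} _ j≤a = cong length (filter-accept (j ≤?_) {xs = xs} j≤a)
  vanish : ∀ {j} → h < j → suc (C j) ≡ 1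
  vanish = cong suc ∘ count≥-> (Linked.tail sorted)

map-diag₀-↭-conj : ∀ {xs} → Linked _>_ xs → map (diag₀ xs) (range1 (part xs 1)) ↭ conj xs
map-diag₀-↭-conj {[]} _ = ↭-refl
map-diag₀-↭-conj {zero ∷ []} _ = ↭-refl
map-diag₀-↭-conj {zero ∷ _ ∷ _} (() ∷ _)
map-diag₀-↭-conj {suc a ∷ xs} strict = begin
  map (diag₀ (suc a ∷ xs)) (range1 (suc a))                 ≡⟨ map-diag₀-∷ strict ⟩
  1 ∷ map suc (map (diag₀ xs) (range1 h)) ++ ones (a ∸ h)  ↭⟨ prep 1 (↭.++⁺ʳ (ones (a ∸ h)) (↭.map⁺ suc ih)) ⟩
  1 ∷ map suc (conj xs) ++ ones (a ∸ h)                    ↭⟨ ↭.shift 1 (map suc (conj xs)) (ones (a ∸ h)) ⟨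
  map suc (conj xs) ++ ones (suc (a ∸ h))                  ≡⟨ cong (λ n → map suc (conj xs) ++ ones n) (+-∸-assoc 1 h≤a) ⟨
  map suc (conj xs) ++ ones (suc a ∸ h)                    ≡⟨ conj-∷ (Linked.map <⇒≤ strict) ⟨
  conj (suc a ∷ xs)                                        ∎
  where
  open PermutationReasoning
  h = part xs 1
  ones = λ n → replicate n 1
  h≤a = strict⇒tail-head≤ strict
  ih = map-diag₀-↭-conj (Linked.tail strict)

diag-range1-positive : ∀ xs → All (1 ≤_) (map (diag xs) (range1 (part xs 1)))
diag-range1-positive xs = All.map⁺ (range1-All positive)
  where
  positive : ∀ {k} → 1 ≤ k → k ≤ part xs 1 → 1 ≤ diag xs k
  positive {k} 1≤k k≤x₁ = subst (1 ≤_) (sym (diag≡diag₀ xs k)) (diag₀-positive xs 1≤k k≤x₁)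

δ-strict : ∀ {xs} → Linked _>_ xs → δ xs ≡ map (diag xs) (range1 (part xs 1))
δ-strict {xs} strict = begin
  δ xs                                                  ≡⟨ δ-trim xs (part xs 1) vanish ⟩
  dropTrailingZeros (map (diag xs) (range1 (part xs 1))) ≡⟨ dropTrailingZeros-positive (diag-range1-positive xs) ⟩
  map (diag xs) (range1 (part xs 1))                    ∎
  where
  open ≡-Reasoning
  vanish : ∀ {k} → part xs 1 < k → diag xs k ≡ 0
  vanish {k} x₁<k = trans (diag≡diag₀ xs k) (diag₀-strict-vanish strict x₁<k)

nonzero-δ-↭-conj : ∀ {xs} → Linked _>_ xs → nonzero (δ xs) ↭ conj xs
nonzero-δ-↭-conj {xs} strict = begin
  nonzero (δ xs)                               ≡⟨ cong nonzero (δ-strict strict) ⟩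
  nonzero (map (diag xs) (range1 (part xs 1))) ≡⟨ filter-all (1 ≤?_) (diag-range1-positive xs) ⟩
  map (diag xs) (range1 (part xs 1))           ≡⟨ map-cong (diag≡diag₀ xs) (range1 (part xs 1)) ⟩
  map (diag₀ xs) (range1 (part xs 1))          ↭⟨ map-diag₀-↭-conj strict ⟩
  conj xs                                      ∎
  where open PermutationReasoning

αbar-head : ℕ → (ℕ → ℕ) → ℕ
αbar-head q s = q + 1 + sum (map (s ∘ suc) (upTo (suc q)))

αbar-suc : ∀ q s → αbar (suc q) s ≡ αbar-head q s ∷ αbar q (s ∘ suc)
αbar-suc q s = cong (αbar-head q s ∷_)
  (trans (cong (map F ∘ map suc) (sym (map-upTo suc q))) (sym (map-∘ (map suc (upTo q)))))
  where
  F = λ i → (suc q ∸ i) + 1 + sum (map (λ k → s (i + k)) (upTo (suc (suc q ∸ i))))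

αbar-head-< : ∀ q s → αbar-head q (s ∘ suc) < αbar-head (suc q) s
αbar-head-< q s = begin-strict
  q + 1 + Σ                  <⟨ s≤s (+-monoʳ-≤ (q + 1) (m≤n+m Σ (s 1))) ⟩
  suc q + 1 + (s 1 + Σ)      ≡⟨ cong (suc q + 1 +_) (sum-map-upTo-suc (s ∘ suc) (suc q)) ⟨
  αbar-head (suc q) s        ∎
  where
  open ≤-Reasoning
  Σ = sum (map (s ∘ suc ∘ suc) (upTo (suc q)))

αbar-strict : ∀ q s → Linked _>_ (αbar q s)
αbar-strict zero s = []
αbar-strict (suc q) s = subst (Linked _>_) (sym (αbar-suc q s)) (head-step q ∷′ αbar-strict q (s ∘ suc))
  where
  head-step : ∀ m → Connected _>_ (just (αbar-head m s)) (head (αbar m (s ∘ suc)))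
  head-step zero = just-nothing
  head-step (suc m) = Connected.just (αbar-head-< m s)

corollary2p6 : (n : ℕ) (α : List ℕ) → IsPartition n α →
    (q : ℕ) (s : ℕ → ℕ) → q > 0 → δ α ≡ shape q s →
    (δ (αbar q s) ≡ δ (conj (αbar q s)))
    × (nonzero (δ (αbar q s)) ↭ conj (αbar q s))
corollary2p6 _ _ _ q s _ _ = sym (δ-conj (Linked.map <⇒≤ strict)) , nonzero-δ-↭-conj strict
  where
  strict : Linked _>_ (αbar q s)
  strict = αbar-strict q s
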